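{- $PC(T(4))=0$, i.e., the perfect binary tree of height $4$ has no $pc$-partition.
   Context: The perfect binary tree $T(h)$ of height $h$ is the rooted tree in which every non-leaf vertex has exactly two children and every leaf is at distance exactly $h$ from the root (so $T(4)$ has 31 vertices). A paired dominating set of $G$ is a dominating set $S$ such that $G[S]$ has a perfect matching. Two disjoint sets form a paired coalition if neither is a paired dominating set but their union is. A $pc$-partition of $G$ is a partition of $V(G)$ into nonempty sets, none a paired dominating set, each forming a paired coalition with some other set of the partition. $PC(G)$ is the maximum number of sets in a $pc$-partition, and $PC(G)=0$ if none exists. -}

module Defs where

open import Data.Nat using (ℕ; zero; suc; _+_; _*_; _∸_; _^_)
open import Data.Fin using (Fin; toℕ)
open import Data.Product using (Σ; ∃; _×_; _,_)
open import Data.Sum using (_⊎_)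
open import Relation.Binary.PropositionalEquality using (_≡_)
open import Relation.Nullary using (¬_)

record Graph : Set₁ where
  field
    n   : ℕ
    Adj : Fin n → Fin n → Set

open Graph public

VSet : Graph → Set₁
VSet G = Fin (n G) → Set

Dominating : (G : Graph) → VSet G → Set
Dominating G S = ∀ v → S v ⊎ (∃ λ u → S u × Adj G u v)

-- G[S] has a perfect matching: a partner map M on S with M v ∈ S,
-- v adjacent to M v, and M (M v) = v (so the edges {v, M v} partition S).
HasPerfectMatching : (G : Graph) → VSet G → Set
HasPerfectMatching G S =
  Σ (Fin (n G) → Fin (n G)) λ M →
    ∀ v → S v → S (M v) × Adj G v (M v) × M (M v) ≡ v

PairedDominating : (G : Graph) → VSet G → Set
PairedDominating G S = Dominating G S × HasPerfectMatching G S

_∪_ : {G : Graph} → VSet G → VSet G → VSet G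
(A ∪ B) v = A v ⊎ B v

PairedCoalition : (G : Graph) → VSet G → VSet G → Set
PairedCoalition G A B =
  ¬ PairedDominating G A × ¬ PairedDominating G B × PairedDominating G (_∪_ {G} A B)

-- A partition of V(G) into k sets, given by a class map f : V → Fin k;
-- class i is f⁻¹(i).  Distinct classes are automatically disjoint.
Class : (G : Graph) {k : ℕ} → (Fin (n G) → Fin k) → Fin k → VSet G
Class G f i v = f v ≡ i

IsPCPartition : (G : Graph) (k : ℕ) → (Fin (n G) → Fin k) → Set
IsPCPartition G k f =
  (∀ i → ∃ λ v → Class G f i v) ×
  (∀ i → ¬ PairedDominating G (Class G f i)) ×
  (∀ i → ∃ λ j → ¬ (i ≡ j) × PairedCoalition G (Class G f i) (Class G f j))

HasPCPartition : Graph → Set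
HasPCPartition G = ∃ λ k → ∃ λ (f : Fin (n G) → Fin k) → IsPCPartition G k f

-- Perfect binary tree T(h): vertices 0 .. 2^(h+1) - 2 in heap order;
-- the children of vertex i are 2i+1 and 2i+2.
ChildOf : ℕ → ℕ → Set
ChildOf p c = (c ≡ 2 * p + 1) ⊎ (c ≡ 2 * p + 2)

T : ℕ → Graph
T h = record
  { n   = 2 ^ (h + 1) ∸ 1
  ; Adj = λ u v → ChildOf (toℕ u) (toℕ v) ⊎ ChildOf (toℕ v) (toℕ u)
  }

-- A coalition union is paired dominating, so it contains every support vertex. Hence, with D the
-- class of the support vertex 7, each union S E = C_E ∪ C_D (E ≠ D) is paired dominating, and no
-- leaf lies in D. If a class E ≠ D colours no leaf of a support vertex s, then s is matched in S E to
-- its parent x; the two supports below x cannot both be, so every class other than D colours one of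
-- the four leaves below x. Besides D there are therefore two, three or four classes, and in each case
-- the matchings of the S E around the root cannot all be completed.
module Submission where

open import Defs
open import Data.Nat using (ℕ)
import Data.Nat as ℕ
open import Data.Fin using (Fin; toℕ; #_; _≟_)
open import Data.Product using (Σ; ∃; _×_; _,_; proj₁; proj₂)
open import Data.Sum using (_⊎_; inj₁; inj₂; [_,_]′)
import Data.Sum as Sum
open import Data.Empty using (⊥; ⊥-elim; ⊥-elim-irr)
open import Data.List using (List; []; _∷_; _++_; filter; allFin)
open import Data.List.Membership.Propositional using (_∈_; _∉_)
open import Data.List.Membership.Propositional.Properties using (∈-filter⁺; ∈-allFin; ∈-++⁺ˡ)
import Data.List.Membership.DecPropositional as DecMembership
open import Data.List.Relation.Unary.Any using (here; there)
open import Data.List.Relation.Unary.All using (All; []; _∷_)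
import Data.List.Relation.Unary.All as All
open import Function using (_∘_; id)
open import Relation.Binary.Definitions using (Symmetric; DecidableEquality)
open import Relation.Binary.PropositionalEquality using (_≡_; _≢_; refl; sym; trans; subst; ≢-sym)
open import Relation.Nullary using (¬_; Dec; yes; no)
open import Relation.Nullary.Decidable using (_⊎-dec_)

module Pigeonhole where

  private variable
    A : Set
    a b c d e p q r u v w y : A
    xs ys : List A

  ∈-remove : ∀ xs → a ≢ y → y ∈ xs ++ a ∷ ys → y ∈ xs ++ ys
  ∈-remove []       a≢y (here refl) = ⊥-elim (a≢y refl)
  ∈-remove []       a≢y (there y∈)  = y∈
  ∈-remove (_ ∷ xs) a≢y (here refl) = here refl
  ∈-remove (_ ∷ xs) a≢y (there y∈)  = there (∈-remove xs a≢y y∈)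

  ∈-pair-swap : e ∈ a ∷ b ∷ [] → e ∈ b ∷ a ∷ []
  ∈-pair-swap (here refl)         = there (here refl)
  ∈-pair-swap (there (here refl)) = here refl

  ∈-pair-of-distinct : u ≢ v → u ∈ a ∷ b ∷ [] → v ∈ a ∷ b ∷ [] →
                       w ∈ a ∷ b ∷ [] → w ∈ u ∷ v ∷ []
  ∈-pair-of-distinct u≢v (here refl)         (here refl)         _                   = ⊥-elim (u≢v refl)
  ∈-pair-of-distinct u≢v (here refl)         (there (here refl)) w∈                  = w∈
  ∈-pair-of-distinct u≢v (there (here refl)) (here refl)         (here refl)         = there (here refl)
  ∈-pair-of-distinct u≢v (there (here refl)) (here refl)         (there (here refl)) = here refl
  ∈-pair-of-distinct u≢v (there (here refl)) (there (here refl)) _                   = ⊥-elim (u≢v refl)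
  ∈-pair-of-distinct u≢v (there (there ()))  _                   _
  ∈-pair-of-distinct u≢v _                   (there (there ()))  _
  ∈-pair-of-distinct u≢v (there (here refl)) (here refl)         (there (there ()))

  three-distinct∉pair : a ≢ b → a ≢ c → b ≢ c →
                        a ∈ u ∷ v ∷ [] → b ∈ u ∷ v ∷ [] → c ∈ u ∷ v ∷ [] → ⊥
  three-distinct∉pair a≢b a≢c b≢c a∈ b∈ c∈ with ∈-pair-of-distinct a≢b a∈ b∈ c∈
  ... | here refl         = a≢c refl
  ... | there (here refl) = b≢c refl

  four-distinct∉triple : a ≢ b → a ≢ c → a ≢ d → b ≢ c → b ≢ d → c ≢ d →
                         a ∈ p ∷ q ∷ r ∷ [] → b ∈ p ∷ q ∷ r ∷ [] →
                         c ∈ p ∷ q ∷ r ∷ [] → d ∈ p ∷ q ∷ r ∷ [] → ⊥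
  four-distinct∉triple a≢b a≢c a≢d b≢c b≢d c≢d a∈ b∈ c∈ d∈ with a∈
  ... | here refl =
    three-distinct∉pair b≢c b≢d c≢d
      (∈-remove [] a≢b b∈) (∈-remove [] a≢c c∈) (∈-remove [] a≢d d∈)
  ... | there (here refl) =
    three-distinct∉pair b≢c b≢d c≢d
      (∈-remove (_ ∷ []) a≢b b∈) (∈-remove (_ ∷ []) a≢c c∈) (∈-remove (_ ∷ []) a≢d d∈)
  ... | there (there (here refl)) =
    three-distinct∉pair b≢c b≢d c≢d
      (∈-remove (_ ∷ _ ∷ []) a≢b b∈) (∈-remove (_ ∷ _ ∷ []) a≢c c∈)
      (∈-remove (_ ∷ _ ∷ []) a≢d d∈)

  meeting-pairs-within-triple : e ∈ a ∷ b ∷ [] → e ∈ c ∷ d ∷ [] →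
    ∃ λ o → ∀ {y} → y ∈ a ∷ b ∷ [] ⊎ y ∈ c ∷ d ∷ [] → y ∈ a ∷ b ∷ o ∷ []
  meeting-pairs-within-triple {d = d} e∈ab (here refl) = d , λ where
    (inj₁ y∈ab)                 → ∈-++⁺ˡ y∈ab
    (inj₂ (here refl))          → ∈-++⁺ˡ e∈ab
    (inj₂ (there (here refl)))  → there (there (here refl))
    (inj₂ (there (there ())))
  meeting-pairs-within-triple {c = c} e∈ab (there (here refl)) = c , λ where
    (inj₁ y∈ab)                 → ∈-++⁺ˡ y∈ab
    (inj₂ (here refl))          → there (there (here refl))
    (inj₂ (there (here refl)))  → ∈-++⁺ˡ e∈ab
    (inj₂ (there (there ())))

  four-distinct∉meeting-pairs : a ≢ b → a ≢ c → a ≢ d → b ≢ c → b ≢ d → c ≢ d →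
    e ∈ p ∷ q ∷ [] → e ∈ u ∷ v ∷ [] →
    All (λ y → y ∈ p ∷ q ∷ [] ⊎ y ∈ u ∷ v ∷ []) (a ∷ b ∷ c ∷ d ∷ []) → ⊥
  four-distinct∉meeting-pairs a≢b a≢c a≢d b≢c b≢d c≢d e∈pq e∈uv (a∈ ∷ b∈ ∷ c∈ ∷ d∈ ∷ [])
    with meeting-pairs-within-triple e∈pq e∈uv
  ... | _ , within = four-distinct∉triple a≢b a≢c a≢d b≢c b≢d c≢d
                       (within a∈) (within b∈) (within c∈) (within d∈)

  module _ {A : Set} (_≟ᴬ_ : DecidableEquality A) where
    open DecMembership _≟ᴬ_ using (_∈?_)

    avoid-two : {a b c : A} → a ≢ b → a ≢ c → b ≢ c → ∀ u v →
                ∃ λ e → e ∈ a ∷ b ∷ c ∷ [] × e ∉ u ∷ v ∷ []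
    avoid-two {a} {b} {c} a≢b a≢c b≢c u v with a ∈? u ∷ v ∷ [] | b ∈? u ∷ v ∷ []
    ... | no a∉  | _      = a , here refl , a∉
    ... | yes _  | no b∉  = b , there (here refl) , b∉
    ... | yes a∈ | yes b∈ = c , there (there (here refl)) , three-distinct∉pair a≢b a≢c b≢c a∈ b∈

    pairs-in-triple-meet : {u v c d p q r : A} → u ≢ v → c ≢ d →
      u ∈ p ∷ q ∷ r ∷ [] → v ∈ p ∷ q ∷ r ∷ [] →
      c ∈ p ∷ q ∷ r ∷ [] → d ∈ p ∷ q ∷ r ∷ [] →
      ∃ λ e → e ∈ u ∷ v ∷ [] × e ∈ c ∷ d ∷ []
    pairs-in-triple-meet {u} {v} {c} {d} u≢v c≢d u∈ v∈ c∈ d∈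
      with u ∈? c ∷ d ∷ [] | v ∈? c ∷ d ∷ []
    ... | yes u∈cd | _        = u , here refl , u∈cd
    ... | no _     | yes v∈cd = v , there (here refl) , v∈cd
    ... | no u∉cd  | no v∉cd  =
      ⊥-elim (four-distinct∉triple u≢v (u∉cd ∘ here) (u∉cd ∘ there ∘ here)
                (v∉cd ∘ here) (v∉cd ∘ there ∘ here) c≢d u∈ v∈ c∈ d∈)

open Pigeonhole

NeighboursAmong : (G : Graph) → Fin (n G) → List (Fin (n G)) → Set
NeighboursAmong G v ws = ∀ {w} → Adj G v w → w ∈ ws

LeafOf : (G : Graph) → Fin (n G) → Fin (n G) → Set
LeafOf G l s = NeighboursAmong G l (s ∷ [])

module PairedDominatingSet {G : Graph} {S : VSet G} (pd : PairedDominating G S) where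

  private variable
    l s v w w′ : Fin (n G)
    ws : List (Fin (n G))

  partner : Fin (n G) → Fin (n G)
  partner = proj₁ (proj₂ pd)

  Matched : Fin (n G) → Fin (n G) → Set
  Matched v w = S v × partner v ≡ w

  matched : S v → Matched v (partner v)
  matched sv = sv , refl

  matched-sym : Matched v w → Matched w v
  matched-sym (sv , refl) = let (s-partner , _ , involutive) = proj₂ (proj₂ pd) _ sv
                            in s-partner , involutive

  matched-functional : Matched v w → Matched v w′ → w ≡ w′
  matched-functional (_ , refl) (_ , refl) = refl

  matched-injective : Matched v w → Matched w′ w → v ≡ w′
  matched-injective m m′ = matched-functional (matched-sym m) (matched-sym m′)

  matched-among : NeighboursAmong G v ws → Matched v w → w ∈ ws
  matched-among nbrs (sv , refl) = nbrs (proj₁ (proj₂ (proj₂ (proj₂ pd) _ sv)))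

  leaf-matched : LeafOf G l s → S l → Matched l s
  leaf-matched leaf sl with matched-among leaf (matched sl)
  ... | here partner≡s = sl , partner≡s

  support-∈ : Symmetric (Adj G) → LeafOf G l s → S s
  support-∈ {l} adj-sym leaf with proj₁ pd l
  ... | inj₁ sl = proj₁ (matched-sym (leaf-matched leaf sl))
  ... | inj₂ (u , su , u-l) with leaf (adj-sym u-l)
  ...   | here refl = su

adj? : ∀ {h} u w → Dec (Adj (T h) u w)
adj? u w = ((toℕ w ℕ.≟ 2 ℕ.* toℕ u ℕ.+ 1) ⊎-dec (toℕ w ℕ.≟ 2 ℕ.* toℕ u ℕ.+ 2))
    ⊎-dec ((toℕ u ℕ.≟ 2 ℕ.* toℕ w ℕ.+ 1) ⊎-dec (toℕ u ℕ.≟ 2 ℕ.* toℕ w ℕ.+ 2))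

T-symmetric : ∀ {h} → Symmetric (Adj (T h))
T-symmetric = Sum.swap

V : Set
V = Fin (n (T 4))

neighbours : V → List V
neighbours v = filter (adj? {4} v) (allFin _)

among : ∀ {v ws} → neighbours v ≡ ws → NeighboursAmong (T 4) v ws
among {v} refl v-w = ∈-filter⁺ (adj? {4} v) (∈-allFin _) v-w

-- Subtreeᵢ v u: v is the root of a copy of T(i) in T(4), hanging from its parent u.
record Subtree₁ (s x : V) : Set where
  constructor subtree₁
  field
    l l′    : V
    nbrs-s  : neighbours s ≡ x ∷ l ∷ l′ ∷ []
    nbrs-l  : neighbours l ≡ s ∷ []
    nbrs-l′ : neighbours l′ ≡ s ∷ []
    l≢l′    : l ≢ l′
    x≢l     : x ≢ l
    x≢l′    : x ≢ l′

record Subtree₂ (x p : V) : Set where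
  constructor subtree₂
  field
    s s′   : V
    left   : Subtree₁ s x
    right  : Subtree₁ s′ x
    nbrs-x : neighbours x ≡ p ∷ s ∷ s′ ∷ []
    s≢s′   : s ≢ s′
    s≢p    : s ≢ p
    s′≢p   : s′ ≢ p

record Subtree₃ (a r : V) : Set where
  constructor subtree₃
  field
    x₁ x₂   : V
    left    : Subtree₂ x₁ a
    right   : Subtree₂ x₂ a
    nbrs-a  : neighbours a ≡ r ∷ x₁ ∷ x₂ ∷ []
    x₁≢x₂   : x₁ ≢ x₂
    r≢x₁    : r ≢ x₁
    r≢x₂    : r ≢ x₂

half₁ : Subtree₃ (# 1) (# 0)
half₁ = subtree₃ _ _
  (subtree₂ _ _
    (subtree₁ _ _ refl refl refl (λ ()) (λ ()) (λ ()))
    (subtree₁ _ _ refl refl refl (λ ()) (λ ()) (λ ()))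
    refl (λ ()) (λ ()) (λ ()))
  (subtree₂ _ _
    (subtree₁ _ _ refl refl refl (λ ()) (λ ()) (λ ()))
    (subtree₁ _ _ refl refl refl (λ ()) (λ ()) (λ ()))
    refl (λ ()) (λ ()) (λ ()))
  refl (λ ()) (λ ()) (λ ())

half₂ : Subtree₃ (# 2) (# 0)
half₂ = subtree₃ _ _
  (subtree₂ _ _
    (subtree₁ _ _ refl refl refl (λ ()) (λ ()) (λ ()))
    (subtree₁ _ _ refl refl refl (λ ()) (λ ()) (λ ()))
    refl (λ ()) (λ ()) (λ ()))
  (subtree₂ _ _
    (subtree₁ _ _ refl refl refl (λ ()) (λ ()) (λ ()))
    (subtree₁ _ _ refl refl refl (λ ()) (λ ()) (λ ()))
    refl (λ ()) (λ ()) (λ ()))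
  refl (λ ()) (λ ()) (λ ())

nbrs-root : neighbours (# 0) ≡ # 1 ∷ # 2 ∷ []
nbrs-root = refl

1≢2 : _≢_ {A = V} (# 1) (# 2)
1≢2 ()

-- The proof of E ≢ D is irrelevant, so that the matching of S E below does not depend on it.
module Hub {k : ℕ} (f : V → Fin k) (D : Fin k)
  (pd : ∀ E → .(E ≢ D) → PairedDominating (T 4) (λ v → f v ≡ E ⊎ f v ≡ D))
  (twin-leaves∉D : ∀ {l l′ s} → LeafOf (T 4) l s → LeafOf (T 4) l′ s → l ≢ l′ → f l ≢ D)
  where

  private variable
    E E′ : Fin k
    a p r s u v w w′ x : V
    ws : List V

  S : Fin k → V → Set
  S E v = f v ≡ E ⊎ f v ≡ D

  module PDS (E : Fin k) .(E≢D : E ≢ D) = PairedDominatingSet (pd E E≢D)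

  Matched : Fin k → V → V → Set
  Matched E v w = Σ (E ≢ D) λ E≢D → PDS.Matched E E≢D v w

  matched : E ≢ D → S E v → ∃ (Matched E v)
  matched E≢D sv = _ , E≢D , PDS.matched _ E≢D sv

  matched-∈ : Matched E v w → S E v
  matched-∈ (_ , sv , _) = sv

  matched-sym : Matched E v w → Matched E w v
  matched-sym (E≢D , m) = E≢D , PDS.matched-sym _ E≢D m

  matched-functional : Matched E v w → Matched E v w′ → w ≡ w′
  matched-functional (E≢D , m) (_ , m′) = PDS.matched-functional _ E≢D m m′

  matched-injective : Matched E v w → Matched E w′ w → v ≡ w′
  matched-injective (E≢D , m) (_ , m′) = PDS.matched-injective _ E≢D m m′

  matched-among : neighbours v ≡ ws → Matched E v w → w ∈ ws
  matched-among nbrs (E≢D , m) = PDS.matched-among _ E≢D (among nbrs) m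

  leaf-matched : E ≢ D → neighbours v ≡ s ∷ [] → S E v → Matched E v s
  leaf-matched E≢D nbrs sv = E≢D , PDS.leaf-matched _ E≢D (among nbrs) sv

  support-∈ : E ≢ D → ∀ l → neighbours l ≡ s ∷ [] → S E s
  support-∈ E≢D l nbrs = PDS.support-∈ _ E≢D (T-symmetric {4}) (among {l} nbrs)

  ∉S : f v ≢ D → f v ≢ E → ¬ S E v
  ∉S fv≢D fv≢E (inj₁ fv≡E) = fv≢E fv≡E
  ∉S fv≢D fv≢E (inj₂ fv≡D) = fv≢D fv≡D

  shared⇒D : E ≢ E′ → S E v → S E′ v → f v ≡ D
  shared⇒D _    (inj₂ fv≡D) _            = fv≡D
  shared⇒D _    (inj₁ _)    (inj₂ fv≡D)  = fv≡D
  shared⇒D E≢E′ (inj₁ fv≡E) (inj₁ fv≡E′) = ⊥-elim (E≢E′ (trans (sym fv≡E) fv≡E′))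

  module _ {s x : V} (t : Subtree₁ s x) where
    open Subtree₁ t

    LeafClass : Fin k → Set
    LeafClass E = E ∈ f l ∷ f l′ ∷ []

    leafClass? : ∀ E → Dec (LeafClass E)
    leafClass? E = DecMembership._∈?_ _≟_ E (f l ∷ f l′ ∷ [])

    l∉D : f l ≢ D
    l∉D = twin-leaves∉D (among nbrs-l) (among nbrs-l′) l≢l′

    l′∉D : f l′ ≢ D
    l′∉D = twin-leaves∉D (among nbrs-l′) (among nbrs-l) (≢-sym l≢l′)

    leafClass≢D : LeafClass E → E ≢ D
    leafClass≢D = All.lookup (l∉D ∷ l′∉D ∷ [])

    leaf-classes-distinct : f l ≢ f l′
    leaf-classes-distinct fl≡fl′ =
      l≢l′ (matched-injective (leaf-matched l∉D nbrs-l (inj₁ refl))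
                              (leaf-matched l∉D nbrs-l′ (inj₁ (sym fl≡fl′))))

    support-matched-up : E ≢ D → ¬ LeafClass E → Matched E s x
    support-matched-up E≢D E∉ with matched E≢D (support-∈ E≢D l nbrs-l)
    ... | w , m with matched-among nbrs-s m | matched-∈ (matched-sym m)
    ...   | here refl                 | _           = m
    ...   | there (here refl)         | inj₁ fl≡E   = ⊥-elim (E∉ (here (sym fl≡E)))
    ...   | there (here refl)         | inj₂ fl≡D   = ⊥-elim (l∉D fl≡D)
    ...   | there (there (here refl)) | inj₁ fl′≡E  = ⊥-elim (E∉ (there (here (sym fl′≡E))))
    ...   | there (there (here refl)) | inj₂ fl′≡D  = ⊥-elim (l′∉D fl′≡D)

    support-matched-up⇒¬LeafClass : Matched E s x → ¬ LeafClass E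
    support-matched-up⇒¬LeafClass m (here refl) =
      x≢l (matched-injective (matched-sym m) (leaf-matched l∉D nbrs-l (inj₁ refl)))
    support-matched-up⇒¬LeafClass m (there (here refl)) =
      x≢l′ (matched-injective (matched-sym m) (leaf-matched l′∉D nbrs-l′ (inj₁ refl)))

  module _ {x p : V} (b : Subtree₂ x p) where
    open Subtree₂ b

    Both : Fin k → Set
    Both E = LeafClass left E × LeafClass right E

    leaf-classes-cover : E ≢ D → LeafClass left E ⊎ LeafClass right E
    leaf-classes-cover {E} E≢D with leafClass? left E | leafClass? right E
    ... | yes E∈ | _      = inj₁ E∈
    ... | no _   | yes E∈ = inj₂ E∈
    ... | no E∉  | no E∉′ = ⊥-elim (s≢s′ (matched-injective (support-matched-up left E≢D E∉)
                                                           (support-matched-up right E≢D E∉′)))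

    absent⇒both : E ≢ D → ¬ S E x → Both E
    absent⇒both {E} E≢D x∉ = in-class left , in-class right
      where
      in-class : ∀ {s} (t : Subtree₁ s x) → LeafClass t E
      in-class t with leafClass? t E
      ... | yes E∈ = E∈
      ... | no E∉  = ⊥-elim (x∉ (matched-∈ (matched-sym (support-matched-up t E≢D E∉))))

    both⇒matched-up : E ≢ D → S E x → Both E → Matched E x p
    both⇒matched-up E≢D sx (E∈ , E∈′) with matched E≢D sx
    ... | w , m with matched-among nbrs-x m
    ...   | here refl                 = m
    ...   | there (here refl)         = ⊥-elim (support-matched-up⇒¬LeafClass left (matched-sym m) E∈)
    ...   | there (there (here refl)) = ⊥-elim (support-matched-up⇒¬LeafClass right (matched-sym m) E∈′)

    matched-up⇒both : Matched E x p → Both E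
    matched-up⇒both {E} m = in-class left s≢p , in-class right s′≢p
      where
      in-class : ∀ {s} (t : Subtree₁ s x) → s ≢ p → LeafClass t E
      in-class t s≢p with leafClass? t E
      ... | yes E∈ = E∈
      ... | no E∉  = ⊥-elim (s≢p (matched-functional (matched-sym (support-matched-up t (proj₁ m) E∉)) m))

  some-class : ∀ v → ∃ λ E → E ≢ D × S E v
  some-class v with f v ≟ D
  ... | yes fv≡D = _ , l∉D (Subtree₂.left (Subtree₃.left half₁)) , inj₂ fv≡D
  ... | no fv≢D  = f v , fv≢D , inj₁ refl

  separated-classes : (∀ {E} → E ≢ D → S E u → S E v → ⊥) → f u ≢ D × f v ≢ D × f u ≢ f v
  separated-classes {u} {v} apart = fu≢D , fv≢D , λ fu≡fv → apart fu≢D (inj₁ refl) (inj₁ (sym fu≡fv))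
    where
    fu≢D : f u ≢ D
    fu≢D fu≡D = let (E , E≢D , sv) = some-class v in apart E≢D (inj₂ fu≡D) sv
    fv≢D : f v ≢ D
    fv≢D fv≡D = let (E , E≢D , su) = some-class u in apart E≢D su (inj₂ fv≡D)

  root-exit : E ≢ D → S E (# 0) → Matched E (# 1) (# 0) ⊎ Matched E (# 2) (# 0)
  root-exit E≢D s-root with matched E≢D s-root
  ... | w , m with matched-among nbrs-root m
  ...   | here refl         = inj₁ (matched-sym m)
  ...   | there (here refl) = inj₂ (matched-sym m)

  exits⇒root∈D : Matched E (# 1) (# 0) → Matched E′ (# 2) (# 0) → f (# 0) ≡ D
  exits⇒root∈D {E} {E′} m m′ with E ≟ E′
  ... | yes refl = ⊥-elim (1≢2 (matched-injective m m′))
  ... | no E≢E′  = shared⇒D E≢E′ (matched-∈ (matched-sym m)) (matched-∈ (matched-sym m′))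

  record TwoClasses : Set where
    field
      P Q   : Fin k
      P≢Q   : P ≢ Q
      cover : ∀ {E} → E ≢ D → E ∈ P ∷ Q ∷ []

  record ThreeClasses : Set where
    field
      P₁ P₂ P₃ : Fin k
      P₁≢P₂    : P₁ ≢ P₂
      P₁≢P₃    : P₁ ≢ P₃
      P₂≢P₃    : P₂ ≢ P₃
      ≢D       : All (_≢ D) (P₁ ∷ P₂ ∷ P₃ ∷ [])
      cover    : ∀ {E} → E ≢ D → E ∈ P₁ ∷ P₂ ∷ P₃ ∷ []

  record FourClasses : Set where
    field
      P₁ P₂ P₃ P₄ : Fin k
      P₁≢P₂       : P₁ ≢ P₂
      P₁≢P₃       : P₁ ≢ P₃
      P₁≢P₄       : P₁ ≢ P₄
      P₂≢P₃       : P₂ ≢ P₃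
      P₂≢P₄       : P₂ ≢ P₄
      P₃≢P₄       : P₃ ≢ P₄
      ≢D          : All (_≢ D) (P₁ ∷ P₂ ∷ P₃ ∷ P₄ ∷ [])

  three-classes : ∀ {α₁ α₂ γ γ′} → α₁ ≢ α₂ → All (_≢ D) (α₁ ∷ α₂ ∷ γ′ ∷ []) →
                  γ ∈ α₁ ∷ α₂ ∷ [] → γ′ ∉ α₁ ∷ α₂ ∷ [] →
                  (∀ {E} → E ≢ D → E ∈ α₁ ∷ α₂ ∷ [] ⊎ E ∈ γ ∷ γ′ ∷ []) → ThreeClasses
  three-classes {α₁} {α₂} {γ} {γ′} α₁≢α₂ ≢D γ∈ γ′∉ cover = record
    { P₁ = α₁ ; P₂ = α₂ ; P₃ = γ′
    ; P₁≢P₂ = α₁≢α₂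
    ; P₁≢P₃ = γ′∉ ∘ here ∘ sym
    ; P₂≢P₃ = γ′∉ ∘ there ∘ here ∘ sym
    ; ≢D = ≢D
    ; cover = [ ∈-++⁺ˡ , second ]′ ∘ cover
    }
    where
    second : ∀ {E} → E ∈ γ ∷ γ′ ∷ [] → E ∈ α₁ ∷ α₂ ∷ γ′ ∷ []
    second (here refl)         = ∈-++⁺ˡ γ∈
    second (there (here refl)) = there (there (here refl))

  module _ {x p : V} (b : Subtree₂ x p) where
    open Subtree₂ b using (left; right)
    open Subtree₁ left using () renaming (l to l₁; l′ to l₂)
    open Subtree₁ right using () renaming (l to l₃; l′ to l₄)

    non-hub-classes : TwoClasses ⊎ ThreeClasses ⊎ FourClasses
    non-hub-classes with leafClass? left (f l₃) | leafClass? left (f l₄)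
    ... | yes l₃∈ | yes l₄∈ = inj₁ record
      { P = f l₁ ; Q = f l₂ ; P≢Q = leaf-classes-distinct left
      ; cover = [ id , right⊆left ]′ ∘ leaf-classes-cover b
      }
      where
      right⊆left : ∀ {E} → LeafClass right E → LeafClass left E
      right⊆left (here refl)         = l₃∈
      right⊆left (there (here refl)) = l₄∈
    ... | yes l₃∈ | no l₄∉ = inj₂ (inj₁ (three-classes (leaf-classes-distinct left)
                               (l∉D left ∷ l′∉D left ∷ l′∉D right ∷ []) l₃∈ l₄∉
                               (leaf-classes-cover b)))
    ... | no l₃∉ | yes l₄∈ = inj₂ (inj₁ (three-classes (leaf-classes-distinct left)
                               (l∉D left ∷ l′∉D left ∷ l∉D right ∷ []) l₄∈ l₃∉
                               (Sum.map₂ ∈-pair-swap ∘ leaf-classes-cover b)))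
    ... | no l₃∉ | no l₄∉ = inj₂ (inj₂ record
      { P₁ = f l₁ ; P₂ = f l₂ ; P₃ = f l₃ ; P₄ = f l₄
      ; P₁≢P₂ = leaf-classes-distinct left
      ; P₁≢P₃ = l₃∉ ∘ here ∘ sym ; P₂≢P₃ = l₃∉ ∘ there ∘ here ∘ sym
      ; P₁≢P₄ = l₄∉ ∘ here ∘ sym ; P₂≢P₄ = l₄∉ ∘ there ∘ here ∘ sym
      ; P₃≢P₄ = leaf-classes-distinct right
      ; ≢D = l∉D left ∷ l′∉D left ∷ l∉D right ∷ l′∉D right ∷ []
      })

  -- A depth-2 vertex in S E is always matched to its parent. So the children of a depth-1 vertex a
  -- never share an S E, hence E is the class of one of them, which then takes a's partner away from
  -- the root; but the root lies in some S E.
  module WithTwoClasses (C : TwoClasses) where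
    open TwoClasses C

    exhaust : E ≢ E′ → E ≢ D → E′ ≢ D → ∀ {F} → F ≢ D → F ∈ E ∷ E′ ∷ []
    exhaust E≢E′ E≢D E′≢D F≢D = ∈-pair-of-distinct E≢E′ (cover E≢D) (cover E′≢D) (cover F≢D)

    always-up₂ : Subtree₂ x p → E ≢ D → S E x → Matched E x p
    always-up₂ {x} {E = E} b E≢D sx =
      both⇒matched-up b E≢D sx (every (Subtree₂.left b) , every (Subtree₂.right b))
      where
      every : (t : Subtree₁ s x) → LeafClass t E
      every t = exhaust (leaf-classes-distinct t) (l∉D t) (l′∉D t) E≢D

    children-apart : (h : Subtree₃ a r) → E ≢ D → S E (Subtree₃.x₁ h) → S E (Subtree₃.x₂ h) → ⊥
    children-apart h E≢D s₁ s₂ =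
      x₁≢x₂ (matched-injective (always-up₂ left E≢D s₁) (always-up₂ right E≢D s₂))
      where open Subtree₃ h

    never-up₃ : Subtree₃ a r → ¬ Matched E a r
    never-up₃ {E = E} h m@(E≢D , _) with separated-classes (children-apart h)
    ... | fx₁≢D , fx₂≢D , fx₁≢fx₂ = child-matched-up (exhaust fx₁≢fx₂ fx₁≢D fx₂≢D E≢D)
      where
      open Subtree₃ h
      child-matched-up : E ∈ f x₁ ∷ f x₂ ∷ [] → ⊥
      child-matched-up (here E≡fx₁) =
        r≢x₁ (matched-injective (matched-sym m) (always-up₂ left E≢D (inj₁ (sym E≡fx₁))))
      child-matched-up (there (here E≡fx₂)) =
        r≢x₂ (matched-injective (matched-sym m) (always-up₂ right E≢D (inj₁ (sym E≡fx₂))))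

    absurd : ⊥
    absurd with some-class (# 0)
    ... | E , E≢D , s-root with root-exit E≢D s-root
    ...   | inj₁ m = never-up₃ half₁ m
    ...   | inj₂ m = never-up₃ half₂ m

  -- Every depth-2 vertex lies in D and is matched to its parent in exactly one S E. So a child a of
  -- the root is matched to the root in S E exactly for the E outside a pair {c₁, c₂}. Each child is
  -- thus matched upwards somewhere, which puts the root in D; but the two pairs meet inside the three
  -- classes, and for a common class the root has no partner.
  module WithThreeClasses (C : ThreeClasses) where
    open ThreeClasses C

    outside : ∀ u v → ∃ λ e → e ∈ P₁ ∷ P₂ ∷ P₃ ∷ [] × e ∉ u ∷ v ∷ []
    outside = avoid-two _≟_ P₁≢P₂ P₁≢P₃ P₂≢P₃

    both-unique : (b : Subtree₂ x p) → Both b E → Both b E′ → E ≡ E′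
    both-unique {E = E} {E′ = E′} b (E∈ , E∈′) (E′∈ , E′∈′) with E ≟ E′
    ... | yes E≡E′ = E≡E′
    ... | no E≢E′  = ⊥-elim (three-distinct∉pair P₁≢P₂ P₁≢P₃ P₂≢P₃
                               (within (here refl)) (within (there (here refl))) (within (there (there (here refl)))))
      where
      within : ∀ {F} → F ∈ P₁ ∷ P₂ ∷ P₃ ∷ [] → F ∈ E ∷ E′ ∷ []
      within F∈ with leaf-classes-cover b (All.lookup ≢D F∈)
      ... | inj₁ F∈l = ∈-pair-of-distinct E≢E′ E∈ E′∈ F∈l
      ... | inj₂ F∈r = ∈-pair-of-distinct E≢E′ E∈′ E′∈′ F∈r

    subtree₂-root∈D : Subtree₂ x p → f x ≡ D
    subtree₂-root∈D {x} b with f x ≟ D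
    ... | yes fx≡D = fx≡D
    ... | no fx≢D with outside (f x) (f x)
    ...   | E , E∈ , E∉ with outside (f x) E
    ...     | E′ , E′∈ , E′∉ =
      ⊥-elim (E′∉ (there (here (both-unique b (absent E′∈ E′∉) (absent E∈ E∉)))))
      where
      absent : ∀ {F G} → F ∈ P₁ ∷ P₂ ∷ P₃ ∷ [] → F ∉ f x ∷ G ∷ [] → Both b F
      absent F∈ F∉ = absent⇒both b (All.lookup ≢D F∈) (∉S fx≢D (F∉ ∘ here ∘ sym))

    some-both : (b : Subtree₂ x p) → ∃ λ c → c ≢ D × Both b c
    some-both b =
      let open Subtree₂ b
          (c , c∈ , c∈′) = pairs-in-triple-meet _≟_
                             (leaf-classes-distinct left) (leaf-classes-distinct right)
                             (cover (l∉D left)) (cover (l′∉D left))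
                             (cover (l∉D right)) (cover (l′∉D right))
      in c , leafClass≢D left c∈ , c∈ , c∈′

    record UpwardProfile (a r : V) : Set where
      field
        c₁ c₂ : Fin k
        c₁≢c₂ : c₁ ≢ c₂
        c₁≢D  : c₁ ≢ D
        c₂≢D  : c₂ ≢ D
        up    : ∀ {E} → E ≢ D → E ∉ c₁ ∷ c₂ ∷ [] → Matched E a r
        ¬up   : ∀ {E} → E ∈ c₁ ∷ c₂ ∷ [] → ¬ Matched E a r

    child-up : (b : Subtree₂ x a) → ∃ λ c → Both b c × Matched c x a
    child-up b with some-both b
    ... | c , c≢D , both = c , both , both⇒matched-up b c≢D (inj₂ (subtree₂-root∈D b)) both

    profile : Subtree₃ a r → UpwardProfile a r
    profile {a} {r} h with child-up (Subtree₃.left h) | child-up (Subtree₃.right h)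
    ... | c₁ , both₁ , up₁ | c₂ , both₂ , up₂ = record
      { c₁ = c₁ ; c₂ = c₂ ; c₁≢c₂ = c₁≢c₂
      ; c₁≢D = proj₁ up₁ ; c₂≢D = proj₁ up₂
      ; up = up ; ¬up = ¬up }
      where
      open Subtree₃ h

      c₁≢c₂ : c₁ ≢ c₂
      c₁≢c₂ c₁≡c₂ =
        x₁≢x₂ (matched-injective up₁ (subst (λ c → Matched c x₂ a) (sym c₁≡c₂) up₂))

      a∈D : f a ≡ D
      a∈D = shared⇒D c₁≢c₂ (matched-∈ (matched-sym up₁)) (matched-∈ (matched-sym up₂))

      up : ∀ {E} → E ≢ D → E ∉ c₁ ∷ c₂ ∷ [] → Matched E a r
      up E≢D E∉ with matched E≢D (inj₂ a∈D)
      ... | w , m with matched-among nbrs-a m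
      ...   | here refl                 = m
      ...   | there (here refl)         =
        ⊥-elim (E∉ (here (both-unique left (matched-up⇒both left (matched-sym m)) both₁)))
      ...   | there (there (here refl)) =
        ⊥-elim (E∉ (there (here (both-unique right (matched-up⇒both right (matched-sym m)) both₂))))

      ¬up : ∀ {E} → E ∈ c₁ ∷ c₂ ∷ [] → ¬ Matched E a r
      ¬up (here refl)         m = r≢x₁ (matched-functional m (matched-sym up₁))
      ¬up (there (here refl)) m = r≢x₂ (matched-functional m (matched-sym up₂))

    module _ (profile₁ : UpwardProfile (# 1) (# 0)) (profile₂ : UpwardProfile (# 2) (# 0)) where
      private
        module L = UpwardProfile profile₁
        module R = UpwardProfile profile₂

      profiles⇒root∈D : f (# 0) ≡ D
      profiles⇒root∈D with outside L.c₁ L.c₂ | outside R.c₁ R.c₂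
      ... | e , e∈ , e∉ | e′ , e′∈ , e′∉ =
        exits⇒root∈D (L.up (All.lookup ≢D e∈) e∉) (R.up (All.lookup ≢D e′∈) e′∉)

      profiles-clash : ⊥
      profiles-clash with pairs-in-triple-meet _≟_ L.c₁≢c₂ R.c₁≢c₂
                            (cover L.c₁≢D) (cover L.c₂≢D) (cover R.c₁≢D) (cover R.c₂≢D)
      ... | F , F∈L , F∈R
          with root-exit (All.lookup (L.c₁≢D ∷ L.c₂≢D ∷ []) F∈L) (inj₂ profiles⇒root∈D)
      ...   | inj₁ m = L.¬up F∈L m
      ...   | inj₂ m = R.¬up F∈R m

    absurd : ⊥
    absurd = profiles-clash (profile half₁) (profile half₂)


  -- No depth-2 vertex is ever matched to its parent, so a child of the root is matched to the root
  -- whenever it is present. Hence the two children carry distinct classes other than D, the root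
  -- lies in D, and in the S E of a third class the root has no partner.
  module WithFourClasses (C : FourClasses) where
    open FourClasses C

    never-up₂ : Subtree₂ x p → ¬ Matched E x p
    never-up₂ b m =
      let (E∈ , E∈′) = matched-up⇒both b m
      in four-distinct∉meeting-pairs P₁≢P₂ P₁≢P₃ P₁≢P₄ P₂≢P₃ P₂≢P₄ P₃≢P₄ E∈ E∈′
           (All.map (leaf-classes-cover b) ≢D)

    always-up₃ : Subtree₃ a r → E ≢ D → S E a → Matched E a r
    always-up₃ h E≢D sa with matched E≢D sa
    ... | w , m with matched-among (Subtree₃.nbrs-a h) m
    ...   | here refl                 = m
    ...   | there (here refl)         = ⊥-elim (never-up₂ (Subtree₃.left h) (matched-sym m))
    ...   | there (there (here refl)) = ⊥-elim (never-up₂ (Subtree₃.right h) (matched-sym m))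

    halves-apart : E ≢ D → S E (# 1) → S E (# 2) → ⊥
    halves-apart E≢D s₁ s₂ =
      1≢2 (matched-injective (always-up₃ half₁ E≢D s₁) (always-up₃ half₂ E≢D s₂))

    absurd : ⊥
    absurd with separated-classes halves-apart
    ... | f₁≢D , f₂≢D , _ with avoid-two _≟_ P₁≢P₂ P₁≢P₃ P₂≢P₃ (f (# 1)) (f (# 2))
    ...   | F , F∈ , F∉
            with root-exit (All.lookup ≢D (∈-++⁺ˡ F∈))
                   (inj₂ (exits⇒root∈D (always-up₃ half₁ f₁≢D (inj₁ refl))
                                        (always-up₃ half₂ f₂≢D (inj₁ refl))))
    ...     | inj₁ m = ∉S f₁≢D (F∉ ∘ here ∘ sym) (matched-∈ m)
    ...     | inj₂ m = ∉S f₂≢D (F∉ ∘ there ∘ here ∘ sym) (matched-∈ m)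

  absurd : ⊥
  absurd = [ WithTwoClasses.absurd , [ WithThreeClasses.absurd , WithFourClasses.absurd ]′ ]′
             (non-hub-classes (Subtree₃.left half₁))

module PCPartition {k : ℕ} (f : V → Fin k)
  (coalitions : ∀ i → ∃ λ j → ¬ i ≡ j × PairedCoalition (T 4) (Class (T 4) f i) (Class (T 4) f j))
  where

  mate : Fin k → Fin k
  mate i = proj₁ (coalitions i)

  U : Fin k → V → Set
  U i v = f v ≡ i ⊎ f v ≡ mate i

  U-pd : ∀ i → PairedDominating (T 4) (U i)
  U-pd i = proj₂ (proj₂ (proj₂ (proj₂ (coalitions i))))

  hub : Fin k
  hub = f (# 7)

  hub-mate : ∀ i → hub ≡ i ⊎ hub ≡ mate i
  hub-mate i = PairedDominatingSet.support-∈ (U-pd i) (T-symmetric {4}) (among {# 15} refl)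

  hub-pd : ∀ E → .(E ≢ hub) → PairedDominating (T 4) (λ v → f v ≡ E ⊎ f v ≡ hub)
  hub-pd E E≢hub with hub-mate E
  ... | inj₁ hub≡E    = ⊥-elim-irr (E≢hub (sym hub≡E))
  ... | inj₂ hub≡mate =
    subst (λ j → PairedDominating (T 4) (λ v → f v ≡ E ⊎ f v ≡ j)) (sym hub≡mate) (U-pd E)

  twin-leaves∉hub : ∀ {l l′ s} → LeafOf (T 4) l s → LeafOf (T 4) l′ s → l ≢ l′ → f l ≢ hub
  twin-leaves∉hub {l} {l′} leaf leaf′ l≢l′ fl≡hub =
    l≢l′ (matched-injective (leaf-matched leaf l∈) (leaf-matched leaf′ (inj₁ refl)))
    where
    open PairedDominatingSet (U-pd (f l′))
    l∈ : U (f l′) l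
    l∈ = Sum.map (trans fl≡hub) (trans fl≡hub) (hub-mate (f l′))

mainTheorem11 : ¬ HasPCPartition (T 4)
mainTheorem11 (k , f , _ , _ , coalitions) = Hub.absurd f hub hub-pd twin-leaves∉hub
  where open PCPartition f coalitions
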